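{- Let $n,m\ge 0$ be integers and consider the algebra $\langle[-n,m];\Rightarrow,0\rangle$. For all $x,y\in[-n,m]$, $x\le y$ if and only if $x\sqsubseteq y$, where $x\sqsubseteq y$ means $(x\Rightarrow y')'=x$. Consequently $\langle[-n,m];\sqsubseteq\rangle\cong\langle[-n,m];\le\rangle$.
   Context: Construction: $[-n,m]=\{x\in\mathbb Z:-n\le x\le m\}$ with usual order $\le$; $p(x)=x-1$ if $x>-n$, $p(-n)=-n$; $0^\ast=m$, $x^\ast=x$ for $x<0$, $x^\ast=p((p(x))^\ast)$ for $x>0$; $x\Rightarrow y=\max(x^\ast,y)$ if $x,y\ge0$ and $\min(x,y)$ otherwise; $x':=x\Rightarrow 0$. -}

module Defs where

open import Data.Nat using (ℕ; zero; suc)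
open import Data.Integer using (ℤ; +_; -_; _-_; _≤_; _<_; _⊔_; _⊓_; -[1+_])
open import Data.Integer.Properties using (_<?_)
open import Data.Product using (Σ; _×_; _,_)
open import Relation.Nullary using (yes; no)
open import Relation.Binary.PropositionalEquality using (_≡_)

module Chain (n m : ℕ) where

  Elem : Set
  Elem = Σ ℤ (λ x → (- (+ n)) ≤ x × x ≤ + m)

  p : ℤ → ℤ
  p x with (- (+ n)) <? x
  ... | yes _ = x - + 1
  ... | no  _ = - (+ n)

  -- 0* = m, x* = x for x < 0, x* = p((p x)*) for x > 0
  -- (for x = k+1 > 0 we have p x = k, since k+1 > -n)
  star : ℤ → ℤ
  star (+ zero)    = + m
  star (+ suc k)   = p (star (+ k))
  star -[1+ k ]    = -[1+ k ]

  _⇒_ : ℤ → ℤ → ℤ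
  (+ a) ⇒ (+ b) = star (+ a) ⊔ (+ b)
  x ⇒ y = x ⊓ y

  _′ : ℤ → ℤ
  x ′ = x ⇒ (+ 0)

  _⊑_ : Elem → Elem → Set
  (x , _) ⊑ (y , _) = ((x ⇒ (y ′)) ′) ≡ x

  _≤ₑ_ : Elem → Elem → Set
  (x , _) ≤ₑ (y , _) = x ≤ y

module Submission where

-- Proof idea.  On the chain [-n,m] the term (x ⇒ y′)′ that defines x ⊑ y is
-- exactly the meet x ⊓ y of the usual order, so x ⊑ y says x ⊓ y = x, which
-- is the lattice characterisation of x ≤ y.
--
-- The only computation is on the non-negative part [0,m]:
--   * p is the predecessor on positive integers (they all lie above -n);
--   * hence the involution * reflects [0,m], a* = m - a, and so does ′;
--   * so for a, b ∈ [0,m]:  a ⇒ b′ = (m - a) ⊔ (m - b) = m - (a ⊓ b),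
--     and applying ′ gives a ⊓ b.
-- When x or y is negative, ⇒ is ⊓ by definition and ′ fixes negatives, so
-- the meet identity holds by computation.  The order isomorphism
-- ⟨[-n,m]; ⊑⟩ ≅ ⟨[-n,m]; ≤⟩ is then the identity map.

open import Defs
open import Data.Nat using (ℕ; zero; suc; _∸_) renaming (_≤_ to _≤ℕ_)
import Data.Nat as ℕ
import Data.Nat.Properties as ℕ
open import Data.Integer using (+_; -_; _≤_; _<_; _⊓_; _⊔_; -[1+_]; +≤+; +<+; -<+)
open import Data.Integer.Properties using (_<?_; i≤j⇒i⊓j≡i; i⊓j≡i⇒i≤j)
open import Data.Product using (_×_; Σ; _,_)
open import Data.Empty using (⊥-elim)
open import Function.Bundles using (_⇔_; _⤖_; Bijection; mk⇔)
open import Function.Construct.Identity using (⤖-id)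
open import Function.Construct.Symmetry using (⇔-sym)
open import Relation.Nullary using (yes; no)
open import Relation.Binary.PropositionalEquality using (_≡_; refl; cong; sym; trans; module ≡-Reasoning)
open ≡-Reasoning

-neg<pos : ∀ n j → - (+ n) < + suc j
-neg<pos zero    j = +<+ (ℕ.s≤s ℕ.z≤n)
-neg<pos (suc _) j = -<+

module _ (n m : ℕ) where
  open Chain n m

  p-suc : ∀ j → p (+ suc j) ≡ + j
  p-suc j with (- (+ n)) <? (+ suc j)
  ... | yes _   = refl
  ... | no  ¬lt = ⊥-elim (¬lt (-neg<pos n j))

  star-reflect : ∀ a → a ≤ℕ m → star (+ a) ≡ + (m ∸ a)
  star-reflect zero    _    = refl
  star-reflect (suc a) a<m = begin
    p (star (+ a))            ≡⟨ cong p (star-reflect a (ℕ.<⇒≤ a<m)) ⟩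
    p (+ (m ∸ a))             ≡⟨ cong (λ k → p (+ k)) (ℕ.+-∸-assoc 1 a<m) ⟩
    p (+ suc (m ∸ suc a))     ≡⟨ p-suc (m ∸ suc a) ⟩
    + (m ∸ suc a)             ∎

  prime-reflect : ∀ a → a ≤ℕ m → (+ a) ′ ≡ + (m ∸ a)
  prime-reflect a a≤m = begin
    star (+ a) ⊔ + 0    ≡⟨ cong (_⊔ + 0) (star-reflect a a≤m) ⟩
    + ((m ∸ a) ℕ.⊔ 0)   ≡⟨ cong +_ (ℕ.⊔-identityʳ (m ∸ a)) ⟩
    + (m ∸ a)           ∎

  -- On [0,m], (a ⇒ b′)′ is the minimum: reflect, take the maximum, reflect back.
  meet-nonneg : ∀ a b → a ≤ℕ m → b ≤ℕ m → (((+ a) ⇒ ((+ b) ′)) ′) ≡ + (a ℕ.⊓ b)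
  meet-nonneg a b a≤m b≤m = begin
    ((+ a) ⇒ ((+ b) ′)) ′           ≡⟨ cong (λ z → ((+ a) ⇒ z) ′) (prime-reflect b b≤m) ⟩
    (star (+ a) ⊔ + (m ∸ b)) ′      ≡⟨ cong (λ z → (z ⊔ + (m ∸ b)) ′) (star-reflect a a≤m) ⟩
    (+ ((m ∸ a) ℕ.⊔ (m ∸ b))) ′     ≡⟨ cong (λ k → (+ k) ′) (sym (ℕ.∸-distribˡ-⊓-⊔ m a b)) ⟩
    (+ (m ∸ (a ℕ.⊓ b))) ′           ≡⟨ prime-reflect (m ∸ (a ℕ.⊓ b)) (ℕ.m∸n≤m m (a ℕ.⊓ b)) ⟩
    + (m ∸ (m ∸ (a ℕ.⊓ b)))         ≡⟨ cong +_ (ℕ.m∸[m∸n]≡n (ℕ.≤-trans (ℕ.m⊓n≤m a b) a≤m)) ⟩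
    + (a ℕ.⊓ b)                     ∎

  ⊑-term≡meet : ((x , _) (y , _) : Elem) → ((x ⇒ (y ′)) ′) ≡ x ⊓ y
  ⊑-term≡meet (+ a    , _ , +≤+ a≤m) (+ b    , _ , +≤+ b≤m) = meet-nonneg a b a≤m b≤m
  ⊑-term≡meet (+ _    , _)           (-[1+ _ ] , _)          = refl
  ⊑-term≡meet (-[1+ a ] , _)         (+ b    , _ , +≤+ b≤m) =
    cong (λ z → (-[1+ a ] ⇒ z) ′) (prime-reflect b b≤m)
  ⊑-term≡meet (-[1+ _ ] , _)         (-[1+ _ ] , _)          = refl

  ≤⇔⊑ : (x y : Elem) → (x ≤ₑ y) ⇔ (x ⊑ y)
  ≤⇔⊑ x y = mk⇔
    (λ x≤y → trans (⊑-term≡meet x y) (i≤j⇒i⊓j≡i x≤y))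
    (λ x⊑y → i⊓j≡i⇒i≤j (trans (sym (⊑-term≡meet x y)) x⊑y))

lemma4p8 : (n m : ℕ) → let open Chain n m in
    ((x y : Elem) → (x ≤ₑ y) ⇔ (x ⊑ y))
    × Σ (Elem ⤖ Elem) (λ f → (x y : Elem) → (x ⊑ y) ⇔ (Bijection.to f x ≤ₑ Bijection.to f y))
lemma4p8 n m = ≤⇔⊑ n m , ⤖-id _ , λ x y → ⇔-sym (≤⇔⊑ n m x y)
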